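{- The conflict resolution calculus $\mathbf{CR}$ is sound: if there is a $\mathbf{CR}$ proof of a clause $c$ from a set of first-order clauses $S$ (i.e. a $\mathbf{CR}$ derivation with conclusion $c$ in which all decision literals are discharged), then $c$ is entailed by $S$ (with all clauses read as universally closed).
   Context: Clauses are finite disjunctions of first-order literals; variables are implicitly universally quantified; $\bar{\ell}$ is the dual of literal $\ell$; $\bot$ is the empty clause with $\Gamma\vee\bot=\Gamma$. Rules work modulo associativity/commutativity of $\vee$, involutivity of negation and neutrality of $\bot$; distinct clauses do not share variables. $\mathbf{CR}$ calculus: derivations are DAGs of clauses whose leaves are clauses of $S$ or decision literals $[\ell]^i$ (arbitrary assumed literals with index $i$), with rules: Unit-propagating resolution $\mathbf{u}(\sigma)$: from unit clauses $\ell_1,\ldots,\ell_n$ and $\bar{\ell'_1}\vee\ldots\vee\bar{\ell'_n}\vee\ell$ infer $\ell\sigma$, $\sigma$ unifying $\ell_k,\ell'_k$ for all $k$; Conflict $\mathbf{c}(\sigma)$: from $\ell$ and $\bar{\ell'}$ infer $\bot$, $\sigma$ unifying $\ell,\ell'$; Conflict-driven clause learning $\mathbf{cl}^i$: from a derivation of $\bot$ using decision literals $[\ell_1]^i,\ldots,[\ell_n]^i$ (and clauses of $S$, previously derived clauses, possibly other undischarged decisions), infer $(\bar{\ell_1}\sigma^1_1\vee\ldots\vee\bar{\ell_1}\sigma^1_{m_1})\vee\ldots\vee(\bar{\ell_n}\sigma^n_1\vee\ldots\vee\bar{\ell_n}\sigma^n_{m_n})$, where $\sigma^k_j$ is the composition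 of substitutions on the $j$-th path from $\ell_k$ to $\bot$; these decisions are discharged. -}

module Defs where

open import Data.Nat using (ℕ; _≤_)
open import Data.Bool using (Bool; true; false; not)
open import Data.List using (List; []; _∷_; _++_; map; length)
open import Data.Product using (_×_; _,_)
open import Data.List.Relation.Unary.All using (All)
open import Data.List.Relation.Unary.Any using (Any)
open import Data.List.Relation.Binary.Pointwise using (Pointwise)
open import Data.List.Relation.Binary.Permutation.Propositional using (_↭_)
open import Data.List.Membership.Propositional using (_∈_)
open import Relation.Binary.PropositionalEquality using (_≡_)
open import Relation.Nullary using (yes; no)
open import Data.Nat using (_≟_)
open import Function.Definitions using (Injective)

data Term : Set where
  var : ℕ → Term
  fn  : ℕ → List Term → Term

Subst : Set
Subst = ℕ → Term

mutual
  _⟨_⟩ : Term → Subst → Term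
  var x    ⟨ σ ⟩ = σ x
  fn f ts  ⟨ σ ⟩ = fn f (ts ⟨ σ ⟩*)

  _⟨_⟩* : List Term → Subst → List Term
  []       ⟨ σ ⟩* = []
  (t ∷ ts) ⟨ σ ⟩* = (t ⟨ σ ⟩) ∷ (ts ⟨ σ ⟩*)

-- literal: polarity (true = positive), predicate symbol, arguments
data Literal : Set where
  lit : Bool → ℕ → List Term → Literal

dual : Literal → Literal
dual (lit b p ts) = lit (not b) p ts

substL : Subst → Literal → Literal
substL σ (lit b p ts) = lit b p (ts ⟨ σ ⟩*)

-- clauses: finite disjunctions, as lists (taken modulo permutation _↭_,
-- which realises associativity/commutativity of ∨); [] is ⊥
Clause : Set
Clause = List Literal

substC : Subst → Clause → Clause
substC σ = map (substL σ)

rename : (ℕ → ℕ) → Subst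
rename ρ x = var (ρ x)

record Structure : Set₁ where
  field
    D     : Set
    inhab : D
    fun   : ℕ → List D → D
    rel   : ℕ → List D → Bool

module _ (M : Structure) where
  open Structure M

  mutual
    eval : (ℕ → D) → Term → D
    eval a (var x)   = a x
    eval a (fn f ts) = fun f (evals a ts)

    evals : (ℕ → D) → List Term → List D
    evals a []       = []
    evals a (t ∷ ts) = eval a t ∷ evals a ts

  LitTrue : (ℕ → D) → Literal → Set
  LitTrue a (lit b p ts) = rel p (evals a ts) ≡ b

  ClauseTrue : (ℕ → D) → Clause → Set
  ClauseTrue a c = Any (LitTrue a) c

  Models : Clause → Set
  Models c = (a : ℕ → D) → ClauseTrue a c

Entails : (Clause → Set) → Clause → Set₁
Entails S c = (M : Structure) → ((c′ : Clause) → S c′ → Models M c′) → Models M c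

-- CR derivations.  A derivation DAG is represented by its tree
-- unfolding (same root-to-leaf paths); rule nodes record the data of
-- the rule instance.

data Tree : Set where
  -- a (renamed variant of a) clause of S
  axiom    : Clause → (ℕ → ℕ) → Tree
  decision : ℕ → Literal → Tree
  -- u(σ): units (derivations of ℓ₁ … ℓₙ), the literals ℓ₁ … ℓₙ,
  -- derivation of the main clause, ℓ′₁ … ℓ′ₙ, ℓ, σ
  unitProp : List Tree → List Literal → Tree → List Literal → Literal → Subst → Tree
  -- c(σ): derivation of ℓ, derivation of ℓ̄′, ℓ, ℓ′, σ
  conflict : Tree → Tree → Literal → Literal → Subst → Tree
  learn    : ℕ → Tree → Tree

-- instances ℓσ¹…σᵐ of the decision literals [ℓ]^i occurring (undischarged
-- by an inner cl^i) in a tree, one for each path from the decision to the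
-- root, where σ¹,…,σᵐ are the substitutions of the rules on that path
mutual
  decs : ℕ → Tree → List Literal
  decs i (axiom c ρ) = []
  decs i (decision j ℓ) with i ≟ j
  ... | yes _ = ℓ ∷ []
  ... | no  _ = []
  decs i (unitProp us ls m ls′ ℓ σ) = map (substL σ) (decsL i us ++ decs i m)
  decs i (conflict a b ℓ ℓ′ σ) = map (substL σ) (decs i a ++ decs i b)
  decs i (learn j t) with i ≟ j
  ... | yes _ = []
  ... | no  _ = decs i t

  decsL : ℕ → List Tree → List Literal
  decsL i []       = []
  decsL i (t ∷ ts) = decs i t ++ decsL i ts

learned : ℕ → Tree → Clause
learned i t = map dual (decs i t)

concl : Tree → Clause
concl (axiom c ρ)                = substC (rename ρ) c
concl (decision i ℓ)             = ℓ ∷ []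
concl (unitProp us ls m ls′ ℓ σ) = substL σ ℓ ∷ []
concl (conflict a b ℓ ℓ′ σ)      = []
concl (learn i t)                = learned i t

data WF (S : Clause → Set) : Tree → Set where
  axiom    : ∀ {c ρ} → S c → Injective _≡_ _≡_ ρ → WF S (axiom c ρ)
  decision : ∀ i ℓ → WF S (decision i ℓ)
  unitProp : ∀ {us ls m ls′ ℓ σ} →
             All (WF S) us → WF S m →
             1 ≤ length ls →
             Pointwise (λ u l → concl u ≡ l ∷ []) us ls →
             concl m ↭ (map dual ls′ ++ ℓ ∷ []) →
             Pointwise (λ l l′ → substL σ l ≡ substL σ l′) ls ls′ →
             WF S (unitProp us ls m ls′ ℓ σ)
  conflict : ∀ {a b ℓ ℓ′ σ} → WF S a → WF S b →
             concl a ≡ ℓ ∷ [] → concl b ≡ dual ℓ′ ∷ [] →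
             substL σ ℓ ≡ substL σ ℓ′ →
             WF S (conflict a b ℓ ℓ′ σ)
  learn    : ∀ {i t} → WF S t → concl t ≡ [] → WF S (learn i t)

-- every decision literal [ℓ]^i is discharged by some cl^i below it
-- (the list holds the indices of the enclosing cl-nodes)
data Discharged : List ℕ → Tree → Set where
  axiom    : ∀ {Γ c ρ} → Discharged Γ (axiom c ρ)
  decision : ∀ {Γ i ℓ} → i ∈ Γ → Discharged Γ (decision i ℓ)
  unitProp : ∀ {Γ us ls m ls′ ℓ σ} → All (Discharged Γ) us → Discharged Γ m →
             Discharged Γ (unitProp us ls m ls′ ℓ σ)
  conflict : ∀ {Γ a b ℓ ℓ′ σ} → Discharged Γ a → Discharged Γ b →
             Discharged Γ (conflict a b ℓ ℓ′ σ)
  learn    : ∀ {Γ i t} → Discharged (i ∷ Γ) t → Discharged Γ (learn i t)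

record CRProof (S : Clause → Set) (c : Clause) : Set where
  field
    tree       : Tree
    wf         : WF S tree
    closed     : Discharged [] tree
    conclusion : concl tree ≡ c

-- Every CR derivation t satisfies, under every assignment a: either the
-- conclusion of t is true, or some instance ℓσ¹…σᵐ of a decision [ℓ]^i still
-- open in t is false.  The rules u and c preserve this because σ unifies the
-- resolved literals, so their premises may be read at the assignment a ∘ σ.
-- The rule cl^i learns exactly the disjunction of the negated instances of
-- the i-decisions, so "an i-decision is false" becomes "the learned clause is
-- true".  In a proof every decision is discharged, hence the second case is
-- impossible and the conclusion is true.
module Submission where

open import Defs
open import Data.Nat using (ℕ; _≟_)
open import Data.Bool using (true; false)
open import Data.Bool.Properties using (not-¬)
open import Data.List using (List; []; _∷_; _++_; map)
open import Data.Product using (∃-syntax; _,_)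
open import Data.Sum using (_⊎_; inj₁; inj₂)
open import Data.Empty using (⊥; ⊥-elim)
open import Data.List.Relation.Unary.All using (All; []; _∷_)
open import Data.List.Relation.Unary.Any using (Any; here; there)
open import Data.List.Relation.Unary.Any.Properties using (¬Any[]; map⁺; map⁻; ++⁺ˡ; ++⁺ʳ; ++⁻)
open import Data.List.Relation.Binary.Pointwise using (Pointwise; []; _∷_)
open import Data.List.Relation.Binary.Permutation.Propositional using (_↭_)
open import Data.List.Relation.Binary.Permutation.Propositional.Properties using (Any-resp-↭)
open import Data.List.Membership.Propositional using (_∉_)
open import Relation.Binary.PropositionalEquality using (_≡_; _≢_; refl; sym; trans; cong; cong₂; subst)
open import Relation.Nullary using (yes; no; ¬_)

dual-substL : ∀ σ ℓ → substL σ (dual ℓ) ≡ dual (substL σ ℓ)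
dual-substL σ (lit b p ts) = refl

decs-decision-self : ∀ i ℓ → decs i (decision i ℓ) ≡ ℓ ∷ []
decs-decision-self i ℓ with i ≟ i
... | yes _  = refl
... | no i≢i = ⊥-elim (i≢i refl)

decs-learn-≢ : ∀ {i j} t → j ≢ i → decs j (learn i t) ≡ decs j t
decs-learn-≢ {i} {j} t j≢i with j ≟ i
... | yes j≡i = ⊥-elim (j≢i j≡i)
... | no _    = refl

mutual
  decs-discharged : ∀ {Γ t} i → Discharged Γ t → i ∉ Γ → decs i t ≡ []
  decs-discharged i axiom i∉Γ = refl
  decs-discharged {t = decision j ℓ} i (decision j∈Γ) i∉Γ with i ≟ j
  ... | yes refl = ⊥-elim (i∉Γ j∈Γ)
  ... | no _     = refl
  decs-discharged i (unitProp dus dm) i∉Γ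
    rewrite decsL-discharged i dus i∉Γ | decs-discharged i dm i∉Γ = refl
  decs-discharged i (conflict da db) i∉Γ
    rewrite decs-discharged i da i∉Γ | decs-discharged i db i∉Γ = refl
  decs-discharged {t = learn j t} i (learn dt) i∉Γ with i ≟ j
  ... | yes _  = refl
  ... | no i≢j = decs-discharged i dt λ { (here i≡j) → i≢j i≡j ; (there i∈Γ) → i∉Γ i∈Γ }

  decsL-discharged : ∀ {Γ ts} i → All (Discharged Γ) ts → i ∉ Γ → decsL i ts ≡ []
  decsL-discharged i []         i∉Γ = refl
  decsL-discharged i (dt ∷ dts) i∉Γ
    rewrite decs-discharged i dt i∉Γ | decsL-discharged i dts i∉Γ = refl

module Semantics (M : Structure) where
  open Structure M

  Assignment : Set
  Assignment = ℕ → D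

  _∘ₛ_ : Assignment → Subst → Assignment
  (a ∘ₛ σ) x = eval M a (σ x)

  mutual
    eval-⟨⟩ : ∀ a σ t → eval M a (t ⟨ σ ⟩) ≡ eval M (a ∘ₛ σ) t
    eval-⟨⟩ a σ (var x)   = refl
    eval-⟨⟩ a σ (fn f ts) = cong (fun f) (evals-⟨⟩* a σ ts)

    evals-⟨⟩* : ∀ a σ ts → evals M a (ts ⟨ σ ⟩*) ≡ evals M (a ∘ₛ σ) ts
    evals-⟨⟩* a σ []       = refl
    evals-⟨⟩* a σ (t ∷ ts) = cong₂ _∷_ (eval-⟨⟩ a σ t) (evals-⟨⟩* a σ ts)

  LitTrue-substL⁺ : ∀ a σ ℓ → LitTrue M (a ∘ₛ σ) ℓ → LitTrue M a (substL σ ℓ)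
  LitTrue-substL⁺ a σ (lit b p ts) = trans (cong (rel p) (evals-⟨⟩* a σ ts))

  LitTrue-substL⁻ : ∀ a σ ℓ → LitTrue M a (substL σ ℓ) → LitTrue M (a ∘ₛ σ) ℓ
  LitTrue-substL⁻ a σ (lit b p ts) = trans (cong (rel p) (sym (evals-⟨⟩* a σ ts)))

  LitTrue-unifier : ∀ {a σ ℓ ℓ′} → substL σ ℓ ≡ substL σ ℓ′ →
                    LitTrue M (a ∘ₛ σ) ℓ → LitTrue M (a ∘ₛ σ) ℓ′
  LitTrue-unifier {a} {σ} {ℓ} {ℓ′} ℓσ≡ℓ′σ ℓ-true =
    LitTrue-substL⁻ a σ ℓ′ (subst (LitTrue M a) ℓσ≡ℓ′σ (LitTrue-substL⁺ a σ ℓ ℓ-true))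

  LitTrue-dual-excluded : ∀ a ℓ → LitTrue M a ℓ → LitTrue M a (dual ℓ) → ⊥
  LitTrue-dual-excluded a (lit b p ts) = not-¬

  LitTrue-dual-total : ∀ a ℓ → LitTrue M a ℓ ⊎ LitTrue M a (dual ℓ)
  LitTrue-dual-total a (lit b p ts) with rel p (evals M a ts)
  LitTrue-dual-total a (lit true  p ts) | true  = inj₁ refl
  LitTrue-dual-total a (lit false p ts) | true  = inj₂ refl
  LitTrue-dual-total a (lit true  p ts) | false = inj₂ refl
  LitTrue-dual-total a (lit false p ts) | false = inj₁ refl

  ClauseTrue-substC : ∀ a σ c → ClauseTrue M (a ∘ₛ σ) c → ClauseTrue M a (substC σ c)
  ClauseTrue-substC a σ (ℓ ∷ c) (here ℓ-true) = here (LitTrue-substL⁺ a σ ℓ ℓ-true)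
  ClauseTrue-substC a σ (ℓ ∷ c) (there c-true) = there (ClauseTrue-substC a σ c c-true)

  Refuted : Assignment → List Literal → Set
  Refuted a = Any (λ ℓ → LitTrue M a (dual ℓ))

  All-true⇒¬Refuted : ∀ {a ls} → All (LitTrue M a) ls → ¬ Refuted a ls
  All-true⇒¬Refuted {a} {ℓ ∷ _} (ℓ-true ∷ _) (here ℓ̄-true) = LitTrue-dual-excluded a ℓ ℓ-true ℓ̄-true
  All-true⇒¬Refuted (_ ∷ rest-true) (there refuted)          = All-true⇒¬Refuted rest-true refuted

  unit-resolvent-true : ∀ {a ls c ℓ} → All (LitTrue M a) ls → ClauseTrue M a c →
                        c ↭ map dual ls ++ ℓ ∷ [] → LitTrue M a ℓ
  unit-resolvent-true {ls = ls} units-true c-true c↭ with ++⁻ (map dual ls) (Any-resp-↭ c↭ c-true)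
  ... | inj₁ dual-true     = ⊥-elim (All-true⇒¬Refuted units-true (map⁻ dual-true))
  ... | inj₂ (here ℓ-true) = ℓ-true

  Refuted-substL : ∀ a σ ls → Refuted (a ∘ₛ σ) ls → Refuted a (map (substL σ) ls)
  Refuted-substL a σ (ℓ ∷ ls) (here ℓ̄-true) = here (subst (LitTrue M a) (dual-substL σ ℓ) (LitTrue-substL⁺ a σ (dual ℓ) ℓ̄-true))
  Refuted-substL a σ (ℓ ∷ ls) (there refuted) = there (Refuted-substL a σ ls refuted)

  ConclusionOrRefutedDecision : Assignment → Tree → Set
  ConclusionOrRefutedDecision a t = ClauseTrue M a (concl t) ⊎ ∃[ i ] Refuted a (decs i t)

  module _ (S : Clause → Set) (M⊨S : (c : Clause) → S c → Models M c) where
    mutual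
      sound : ∀ {t} → WF S t → ∀ a → ConclusionOrRefutedDecision a t
      sound (axiom {c} {ρ} c∈S _) a =
        inj₁ (ClauseTrue-substC a (rename ρ) c (M⊨S c c∈S (a ∘ₛ rename ρ)))
      sound (decision i ℓ) a with LitTrue-dual-total a ℓ
      ... | inj₁ ℓ-true = inj₁ (here ℓ-true)
      ... | inj₂ ℓ̄-true = inj₂ (i , subst (Refuted a) (sym (decs-decision-self i ℓ)) (here ℓ̄-true))
      sound (unitProp {us} {m = m} {ℓ = ℓ} {σ = σ} wf-us wf-m _ us-concl m↭ ls-unified) a
        with sound-units wf-us us-concl ls-unified a
      ... | inj₂ (i , refuted) =
        inj₂ (i , Refuted-substL a σ (decsL i us ++ decs i m) (++⁺ˡ refuted))
      ... | inj₁ units-true with sound wf-m (a ∘ₛ σ)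
      ...   | inj₂ (i , refuted) =
        inj₂ (i , Refuted-substL a σ (decsL i us ++ decs i m) (++⁺ʳ (decsL i us) refuted))
      ...   | inj₁ m-true =
        inj₁ (here (LitTrue-substL⁺ a σ ℓ (unit-resolvent-true units-true m-true m↭)))
      sound (conflict {l} {r} {ℓ′ = ℓ′} {σ = σ} wf-l wf-r l-concl r-concl ℓσ≡ℓ′σ) a
        with sound wf-l (a ∘ₛ σ) | sound wf-r (a ∘ₛ σ)
      ... | inj₂ (i , refuted) | _ =
        inj₂ (i , Refuted-substL a σ (decs i l ++ decs i r) (++⁺ˡ refuted))
      ... | inj₁ _ | inj₂ (i , refuted) =
        inj₂ (i , Refuted-substL a σ (decs i l ++ decs i r) (++⁺ʳ (decs i l) refuted))
      ... | inj₁ l-true | inj₁ r-true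
        with subst (ClauseTrue M (a ∘ₛ σ)) l-concl l-true
           | subst (ClauseTrue M (a ∘ₛ σ)) r-concl r-true
      ...   | here ℓ-true | here ℓ̄′-true =
        ⊥-elim (LitTrue-dual-excluded (a ∘ₛ σ) ℓ′ (LitTrue-unifier ℓσ≡ℓ′σ ℓ-true) ℓ̄′-true)
      sound (learn {i} {t} wf-t t-concl) a with sound wf-t a
      ... | inj₁ t-true = ⊥-elim (¬Any[] (subst (ClauseTrue M a) t-concl t-true))
      ... | inj₂ (j , refuted) with j ≟ i
      ...   | yes refl = inj₁ (map⁺ refuted)
      ...   | no j≢i   = inj₂ (j , subst (Refuted a) (sym (decs-learn-≢ t j≢i)) refuted)

      sound-units : ∀ {us ls ls′ σ} → All (WF S) us →
                    Pointwise (λ u ℓ → concl u ≡ ℓ ∷ []) us ls →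
                    Pointwise (λ ℓ ℓ′ → substL σ ℓ ≡ substL σ ℓ′) ls ls′ →
                    ∀ a → All (LitTrue M (a ∘ₛ σ)) ls′ ⊎ ∃[ i ] Refuted (a ∘ₛ σ) (decsL i us)
      sound-units [] [] [] a = inj₁ []
      sound-units {u ∷ _} {σ = σ} (wf-u ∷ wf-us) (u-concl ∷ us-concl) (ℓσ≡ℓ′σ ∷ ls-unified) a
        with sound wf-u (a ∘ₛ σ)
      ... | inj₂ (i , refuted) = inj₂ (i , ++⁺ˡ refuted)
      ... | inj₁ u-true with sound-units wf-us us-concl ls-unified a
      ...   | inj₂ (i , refuted) = inj₂ (i , ++⁺ʳ (decs i u) refuted)
      ...   | inj₁ rest-true with subst (ClauseTrue M (a ∘ₛ σ)) u-concl u-true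
      ...     | here ℓ-true = inj₁ (LitTrue-unifier ℓσ≡ℓ′σ ℓ-true ∷ rest-true)

open Semantics using (sound; Refuted)

corollary2 : (S : Clause → Set) (c : Clause) → CRProof S c → Entails S c
corollary2 S c proof M M⊨S a with sound M S M⊨S (CRProof.wf proof) a
... | inj₁ concl-true = subst (ClauseTrue M a) (CRProof.conclusion proof) concl-true
... | inj₂ (i , refuted) =
  ⊥-elim (¬Any[] (subst (Refuted M a) (decs-discharged i (CRProof.closed proof) λ ()) refuted))
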